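{- Let $q$ be a prime power, $n>1$, $b\in\mathbb F_{q^n}\setminus\mathbb F_q$ and $c\in\mathbb F_{q^n}^*$. The following are equivalent: (i) $x+\frac{c}{\operatorname{Tr}(x)+b}$ is a permutation rational function of $\mathbb F_{q^n}$; (ii) $x+\operatorname{Tr}\left(\frac{c}{x+b}\right)$ is a permutation rational function of $\mathbb F_q$; (iii) $\operatorname{Tr}\left(\frac{c}{(x_0+b)(y_0+b)}\right)\ne 1$ for all $x_0,y_0\in\mathbb F_q$ with $x_0\ne y_0$.
   Context: $\operatorname{Tr}:\mathbb F_{q^n}\to\mathbb F_q$ is the trace map $\operatorname{Tr}(x)=\sum_{i=0}^{n-1}x^{q^i}$. Since $b\notin\mathbb F_q$, the denominators $\operatorname{Tr}(x)+b$ (for $x\in\mathbb F_{q^n}$) and $x+b$ (for $x\in\mathbb F_q$) never vanish, so the first function defines a map $\mathbb F_{q^n}\to\mathbb F_{q^n}$ and the second a map $\mathbb F_q\to\mathbb F_q$. A rational function is called a permutation rational function of a field if the map it induces on that field is a bijection. -}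

module Defs where

open import Level using (0ℓ)
open import Data.Nat using (ℕ; zero; suc; _<_) renaming (_^_ to _^ℕ_)
open import Data.Nat.Primality using (Prime)
open import Data.Fin using (Fin)
open import Data.Product using (_×_; Σ; ∃; ∃-syntax; _,_)
open import Relation.Binary.PropositionalEquality using (_≡_; _≢_)
open import Relation.Nullary using (¬_)
open import Algebra.Structures using (IsCommutativeRing)
open import Function.Bundles using (_↔_)
open import Function.Definitions using (Bijective)

IsPrimePower : ℕ → Set
IsPrimePower q = ∃[ p ] ∃[ k ] (Prime p × 0 < k × q ≡ p ^ℕ k)

record FiniteField : Set₁ where
  infixl 6 _+_
  infixl 7 _*_
  field
    Carrier : Set
    _+_ _*_ : Carrier → Carrier → Carrier
    -_ : Carrier → Carrier
    0# 1# : Carrier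
    isCommutativeRing : IsCommutativeRing _≡_ _+_ _*_ -_ 0# 1#
    0≢1 : 0# ≢ 1#
    -- multiplicative inverse (its value at 0# is irrelevant and unconstrained)
    _⁻¹ : Carrier → Carrier
    ⁻¹-inverse : ∀ x → x ≢ 0# → x * (x ⁻¹) ≡ 1#
    card : ℕ
    enum : Fin card ↔ Carrier

  infixr 8 _^_
  _^_ : Carrier → ℕ → Carrier
  x ^ zero = 1#
  x ^ suc m = x * (x ^ m)

  _/_ : Carrier → Carrier → Carrier
  x / y = x * (y ⁻¹)

module FieldExt (K : FiniteField) (q n : ℕ) where
  open FiniteField K

  InFq : Carrier → Set
  InFq x = x ^ q ≡ x

  traceSum : ℕ → Carrier → Carrier
  traceSum zero x = 0#
  traceSum (suc m) x = traceSum m x + x ^ (q ^ℕ m)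

  Tr : Carrier → Carrier
  Tr = traceSum n

  PermutesK : (Carrier → Carrier) → Set
  PermutesK f = Bijective _≡_ _≡_ f

  PermutesFq : (Carrier → Carrier) → Set
  PermutesFq f =
    (∀ x → InFq x → InFq (f x))
    × (∀ x y → InFq x → InFq y → f x ≡ f y → x ≡ y)
    × (∀ y → InFq y → Σ Carrier λ x → InFq x × f x ≡ y)

-- Since Tr (f x) = g (Tr x) for f x = x + c / (Tr x + b) and g x = x + Tr (c / (x + b)),
-- and Tr maps F_{q^n} onto F_q, f is injective exactly when g is injective on F_q:
-- f x = f y forces Tr x = Tr y and then x = y, while g x = g y lifts along any z with
-- Tr z = x to f z = f (z + c / (x + b) - c / (y + b)).  For x, y in F_q,
-- g x - g y = (x - y) (1 - Tr (c / ((x + b) (y + b)))), which gives (ii) ⇔ (iii); by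
-- finiteness injectivity is enough.  Underneath, x ↦ x ^ q is additive (Frobenius:
-- p ∣ C(p, j) and p · 1 = 0), so F_q = {x | x ^ q = x} is a subfield, Tr is F_q-linear
-- with values in F_q (as x ^ (q ^ n) = x), and Tr is onto F_q because, as a polynomial
-- of degree q ^ (n - 1) < q ^ n, it does not vanish on all of F_{q^n}.

module Submission where

open import Level using (0ℓ)
open import Data.Nat as ℕ using (ℕ; zero; suc; _<_; _∸_; _!; s≤s; z≤n)
import Data.Nat.Properties as ℕ
open import Data.Nat.Primality using (Prime; euclidsLemma; prime⇒nonTrivial)
open import Data.Nat.Divisibility using (_∣_; divides; ∣1⇒≡1; ∣⇒≤; m∣m*n)
open import Data.Nat.Combinatorics using (_C_; nCk≡n!/k![n-k]!; k![n∸k]!∣n!; nCn≡1)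
open import Data.Nat.DivMod using (m*[n/m]≡n)
open import Data.Fin as Fin using (Fin)
import Data.Fin.Properties as Fin
open import Data.Fin.Permutation using (Permutation)
open import Data.Product using (Σ; _×_; _,_; proj₁; proj₂; ∃-syntax)
open import Data.Product.Properties using (≡-dec)
open import Data.Sum using (_⊎_; inj₁; inj₂; [_,_])
open import Data.Empty using (⊥-elim)
open import Data.Maybe using (Maybe; map)
open import Data.Vec.Functional using (replicate)
open import Algebra.Bundles using (CommutativeRing; CommutativeMonoid; RawRing)
open import Algebra.Solver.Ring.AlmostCommutativeRing
import Algebra.Properties.Semiring.Binomial as Binomial
open import Function.Base using (_∘_; id)
open import Function.Bundles using (Inverse; mk↔ₛ′; _⇔_; mk⇔)
open import Function.Definitions using (Bijective)
open import Relation.Binary.Definitions using (DecidableEquality)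
open import Relation.Binary.PropositionalEquality
  using (_≡_; _≢_; refl; sym; trans; cong; cong₂; subst; module ≡-Reasoning)
open import Relation.Nullary using (yes; no; ¬_; Dec)
open import Relation.Nullary.Decidable using (map′; dec⇒maybe)
open import Defs

-- Ring solver with integer coefficients, usable in rings (like a finite field
-- given abstractly) whose own elements do not normalise by evaluation.  A pair
-- (a , b) denotes a − b and is kept normalised (one component zero), so that
-- equal coefficients computed by the solver are syntactically equal.
module IntegerPairCoefficients {c ℓ} (R : CommutativeRing c ℓ) where
  open CommutativeRing R renaming (refl to ≈-refl; sym to ≈-sym; trans to ≈-trans)
  open import Algebra.Properties.Semiring.Mult semiring using (×-homo-+; ×1-homo-*)
    renaming (_×_ to _·_)
  open import Algebra.Properties.Ring ring using (-‿distribˡ-*; -‿distribʳ-*; -‿+-comm; ⁻¹-anti-homo‿-; -‿involutive; -0#≈0#)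
  open import Algebra.Properties.CommutativeSemigroup +-commutativeSemigroup using (interchange)
  open import Relation.Binary.Reasoning.Setoid setoid

  ℤ² : Set
  ℤ² = ℕ × ℕ

  ⟦_⟧ℤ : ℤ² → Carrier
  ⟦ a , b ⟧ℤ = a · 1# - b · 1#

  normalise : ℤ² → ℤ²
  normalise (a , b) = (a ∸ b , b ∸ a)

  -‿+-distrib : ∀ x y → - (x + y) ≈ - x + - y
  -‿+-distrib x y = ≈-sym (-‿+-comm x y)

  +-sub-+ : ∀ x y z w → (x + y) - (z + w) ≈ (x - z) + (y - w)
  +-sub-+ x y z w = ≈-trans (+-congˡ (-‿+-distrib z w)) (interchange x y (- z) (- w))

  ⟦normalise⟧ : ∀ a b → ⟦ normalise (a , b) ⟧ℤ ≈ ⟦ a , b ⟧ℤ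
  ⟦normalise⟧ zero    zero    = ≈-refl
  ⟦normalise⟧ zero    (suc b) = ≈-refl
  ⟦normalise⟧ (suc a) zero    = ≈-refl
  ⟦normalise⟧ (suc a) (suc b) = begin
    ⟦ normalise (a , b) ⟧ℤ           ≈⟨ ⟦normalise⟧ a b ⟩
    a · 1# - b · 1#                  ≈⟨ +-identityˡ _ ⟨
    0# + (a · 1# - b · 1#)           ≈⟨ +-congʳ (-‿inverseʳ 1#) ⟨
    (1# - 1#) + (a · 1# - b · 1#)    ≈⟨ +-sub-+ 1# (a · 1#) 1# (b · 1#) ⟨
    suc a · 1# - suc b · 1#          ∎

  _+ℤ_ _*ℤ_ : ℤ² → ℤ² → ℤ²
  (a , b) +ℤ (c , d) = normalise (a ℕ.+ c , b ℕ.+ d)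
  (a , b) *ℤ (c , d) = normalise (a ℕ.* c ℕ.+ b ℕ.* d , a ℕ.* d ℕ.+ b ℕ.* c)

  ℤ²-rawRing : RawRing 0ℓ 0ℓ
  ℤ²-rawRing = record
    { Carrier = ℤ² ; _≈_ = _≡_ ; _+_ = _+ℤ_ ; _*_ = _*ℤ_
    ; -_ = λ (a , b) → (b , a) ; 0# = (0 , 0) ; 1# = (1 , 0) }

  ⟦⟧-homo-+ : ∀ p q → ⟦ p +ℤ q ⟧ℤ ≈ ⟦ p ⟧ℤ + ⟦ q ⟧ℤ
  ⟦⟧-homo-+ (a , b) (c , d) = begin
    ⟦ normalise (a ℕ.+ c , b ℕ.+ d) ⟧ℤ        ≈⟨ ⟦normalise⟧ (a ℕ.+ c) (b ℕ.+ d) ⟩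
    (a ℕ.+ c) · 1# - (b ℕ.+ d) · 1#          ≈⟨ +-cong (×-homo-+ 1# a c) (-‿cong (×-homo-+ 1# b d)) ⟩
    (a · 1# + c · 1#) - (b · 1# + d · 1#)    ≈⟨ +-sub-+ _ _ _ _ ⟩
    ⟦ a , b ⟧ℤ + ⟦ c , d ⟧ℤ                  ∎

  [x-y][z-w] : ∀ x y z w → (x - y) * (z - w) ≈ (x * z + y * w) - (x * w + y * z)
  [x-y][z-w] x y z w = begin
    (x - y) * (z - w)                          ≈⟨ distribʳ (z - w) x (- y) ⟩
    x * (z - w) + - y * (z - w)                ≈⟨ +-cong (distribˡ x z (- w)) (distribˡ (- y) z (- w)) ⟩
    (x * z + x * - w) + (- y * z + - y * - w)  ≈⟨ +-cong (+-congˡ (≈-sym (-‿distribʳ-* x w)))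
                                                         (+-cong (≈-sym (-‿distribˡ-* y z)) -y*-w≈yw) ⟩
    (x * z - x * w) + (- (y * z) + y * w)      ≈⟨ +-congˡ (+-comm _ _) ⟩
    (x * z - x * w) + (y * w - y * z)          ≈⟨ interchange _ _ _ _ ⟩
    (x * z + y * w) + (- (x * w) - y * z)      ≈⟨ +-congˡ (-‿+-distrib (x * w) (y * z)) ⟨
    (x * z + y * w) - (x * w + y * z)          ∎
    where
    -y*-w≈yw : - y * - w ≈ y * w
    -y*-w≈yw = ≈-trans (≈-sym (-‿distribˡ-* y (- w)))
                 (≈-trans (-‿cong (≈-sym (-‿distribʳ-* y w))) (-‿involutive (y * w)))

  ⟦⟧-homo-* : ∀ p q → ⟦ p *ℤ q ⟧ℤ ≈ ⟦ p ⟧ℤ * ⟦ q ⟧ℤ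
  ⟦⟧-homo-* (a , b) (c , d) = begin
    ⟦ normalise (a ℕ.* c ℕ.+ b ℕ.* d , a ℕ.* d ℕ.+ b ℕ.* c) ⟧ℤ
      ≈⟨ ⟦normalise⟧ (a ℕ.* c ℕ.+ b ℕ.* d) (a ℕ.* d ℕ.+ b ℕ.* c) ⟩
    (a ℕ.* c ℕ.+ b ℕ.* d) · 1# - (a ℕ.* d ℕ.+ b ℕ.* c) · 1#
      ≈⟨ +-cong (·1-homo a c b d) (-‿cong (·1-homo a d b c)) ⟩
    (a′ * c′ + b′ * d′) - (a′ * d′ + b′ * c′)
      ≈⟨ [x-y][z-w] a′ b′ c′ d′ ⟨
    ⟦ a , b ⟧ℤ * ⟦ c , d ⟧ℤ ∎
    where
    a′ = a · 1#; b′ = b · 1#; c′ = c · 1#; d′ = d · 1#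
    ·1-homo : ∀ a c b d → (a ℕ.* c ℕ.+ b ℕ.* d) · 1# ≈ a · 1# * c · 1# + b · 1# * d · 1#
    ·1-homo a c b d = ≈-trans (×-homo-+ 1# (a ℕ.* c) (b ℕ.* d)) (+-cong (×1-homo-* a c) (×1-homo-* b d))

  homomorphism : ℤ²-rawRing -Raw-AlmostCommutative⟶ fromCommutativeRing R
  homomorphism = record
    { ⟦_⟧    = ⟦_⟧ℤ
    ; +-homo = ⟦⟧-homo-+
    ; *-homo = ⟦⟧-homo-*
    ; -‿homo = λ (a , b) → ≈-sym (⁻¹-anti-homo‿- (a · 1#) (b · 1#))
    ; 0-homo = -‿inverseʳ 0#
    ; 1-homo = ≈-trans (+-congˡ -0#≈0#) (≈-trans (+-identityʳ _) (+-identityʳ 1#))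
    }

  ⟦⟧-weaklyDecidable : ∀ p q → Maybe (⟦ p ⟧ℤ ≈ ⟦ q ⟧ℤ)
  ⟦⟧-weaklyDecidable p q = map (λ p≡q → reflexive (cong ⟦_⟧ℤ p≡q)) (dec⇒maybe (≡-dec ℕ._≟_ ℕ._≟_ p q))

  open import Algebra.Solver.Ring ℤ²-rawRing (fromCommutativeRing R) homomorphism ⟦⟧-weaklyDecidable public
    using (solve; _:+_; _:*_; :-_; _:-_; _:=_)

Fin-injective⇒surjective : ∀ {m} (f : Fin m → Fin m) → (∀ i j → f i ≡ f j → i ≡ j) → ∀ y → ∃[ x ] f x ≡ y
Fin-injective⇒surjective {suc m} f inj y with Fin.any? (λ i → f i Fin.≟ y)
... | yes found = found
... | no missed with Fin.pigeonhole (ℕ.n<1+n m) (λ i → Fin.punchOut (missed-at i))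
  where
  missed-at : ∀ i → y ≢ f i
  missed-at i y≡fi = missed (i , sym y≡fi)
... | i , j , i<j , same = ⊥-elim (ℕ.<-irrefl (cong Fin.toℕ i≡j) i<j)
  where
  i≡j : i ≡ j
  i≡j = inj i j (Fin.punchOut-injective (λ e → missed (i , sym e)) (λ e → missed (j , sym e)) same)

module FiniteFieldProperties (K : FiniteField) where
  open FiniteField K
  open Inverse enum using (to; from; strictlyInverseˡ; strictlyInverseʳ)

  commutativeRing : CommutativeRing 0ℓ 0ℓ
  commutativeRing = record { isCommutativeRing = isCommutativeRing }

  open CommutativeRing commutativeRing public
    using (+-comm; *-assoc; *-comm; +-identityˡ; +-identityʳ; *-identityˡ; *-identityʳ;
           distribˡ; -‿inverseʳ; zeroˡ; zeroʳ; semiring; ring;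
           +-commutativeMonoid; *-commutativeMonoid)
  open import Algebra.Properties.Ring ring public
    using (-‿+-comm; -0#≈0#; x∙y⁻¹≈ε⇒x≈y; +-cancelʳ; x+x≈x⇒x≈0; +-inverseʳ-unique; +-identityʳ-unique; x[y-z]≈xy-xz; x≈y⇒x∙y⁻¹≈ε)
  open import Algebra.Properties.CommutativeSemigroup (CommutativeRing.+-commutativeSemigroup commutativeRing) public
    using (interchange)
  open IntegerPairCoefficients commutativeRing public using (solve; _:+_; _:*_; :-_; _:-_; _:=_)

  from-injective : ∀ x y → from x ≡ from y → x ≡ y
  from-injective x y e = trans (sym (strictlyInverseˡ x)) (trans (cong to e) (strictlyInverseˡ y))

  to-injective : ∀ i j → to i ≡ to j → i ≡ j
  to-injective i j e = trans (sym (strictlyInverseʳ i)) (trans (cong from e) (strictlyInverseʳ j))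

  infix 4 _≟_
  _≟_ : DecidableEquality Carrier
  x ≟ y = map′ (from-injective x y) (cong from) (from x Fin.≟ from y)

  x-y≡0⇒x≡y : ∀ x y → x + - y ≡ 0# → x ≡ y
  x-y≡0⇒x≡y = x∙y⁻¹≈ε⇒x≈y

  x≡y⇒x-y≡0 : ∀ {x y} → x ≡ y → x + - y ≡ 0#
  x≡y⇒x-y≡0 = x≈y⇒x∙y⁻¹≈ε

  ⁻¹-inverseˡ : ∀ x → x ≢ 0# → x ⁻¹ * x ≡ 1#
  ⁻¹-inverseˡ x x≢0 = trans (*-comm _ _) (⁻¹-inverse x x≢0)

  y≡x⁻¹[xy] : ∀ {x} y → x ≢ 0# → y ≡ x ⁻¹ * (x * y)
  y≡x⁻¹[xy] {x} y x≢0 = begin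
    y                ≡⟨ *-identityˡ y ⟨
    1# * y           ≡⟨ cong (_* y) (⁻¹-inverseˡ x x≢0) ⟨
    (x ⁻¹ * x) * y   ≡⟨ *-assoc _ _ _ ⟩
    x ⁻¹ * (x * y)   ∎
    where open ≡-Reasoning

  x≢0⇒x*y≡0⇒y≡0 : ∀ {x y} → x ≢ 0# → x * y ≡ 0# → y ≡ 0#
  x≢0⇒x*y≡0⇒y≡0 {x} {y} x≢0 xy≡0 =
    trans (y≡x⁻¹[xy] y x≢0) (trans (cong (x ⁻¹ *_) xy≡0) (zeroʳ _))

  x*y≡0⇒x≡0⊎y≡0 : ∀ x y → x * y ≡ 0# → x ≡ 0# ⊎ y ≡ 0#
  x*y≡0⇒x≡0⊎y≡0 x y xy≡0 with x ≟ 0#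
  ... | yes x≡0 = inj₁ x≡0
  ... | no x≢0  = inj₂ (x≢0⇒x*y≡0⇒y≡0 x≢0 xy≡0)

  x≢0∧y≢0⇒x*y≢0 : ∀ {x y} → x ≢ 0# → y ≢ 0# → x * y ≢ 0#
  x≢0∧y≢0⇒x*y≢0 x≢0 y≢0 xy≡0 = y≢0 (x≢0⇒x*y≡0⇒y≡0 x≢0 xy≡0)

  ⁻¹-unique : ∀ x y → x * y ≡ 1# → y ≡ x ⁻¹
  ⁻¹-unique x y xy≡1 with x ≟ 0#
  ... | yes refl = ⊥-elim (0≢1 (trans (sym (zeroˡ y)) xy≡1))
  ... | no x≢0   = trans (y≡x⁻¹[xy] y x≢0) (trans (cong (x ⁻¹ *_) xy≡1) (*-identityʳ _))

  ⁻¹-distrib-* : ∀ {x y} → x ≢ 0# → y ≢ 0# → (x * y) ⁻¹ ≡ x ⁻¹ * y ⁻¹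
  ⁻¹-distrib-* {x} {y} x≢0 y≢0 = sym (⁻¹-unique (x * y) (x ⁻¹ * y ⁻¹) (begin
    (x * y) * (x ⁻¹ * y ⁻¹)      ≡⟨ solve 4 (λ x y x′ y′ → (x :* y) :* (x′ :* y′) := (x :* x′) :* (y :* y′)) refl x y (x ⁻¹) (y ⁻¹) ⟩
    (x * x ⁻¹) * (y * y ⁻¹)      ≡⟨ cong₂ _*_ (⁻¹-inverse x x≢0) (⁻¹-inverse y y≢0) ⟩
    1# * 1#                      ≡⟨ *-identityʳ 1# ⟩
    1#                           ∎))
    where open ≡-Reasoning

  ^-+ : ∀ x m n → x ^ (m ℕ.+ n) ≡ x ^ m * x ^ n
  ^-+ x zero    n = sym (*-identityˡ _)
  ^-+ x (suc m) n = trans (cong (x *_) (^-+ x m n)) (sym (*-assoc _ _ _))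

  *-^ : ∀ x y n → (x * y) ^ n ≡ x ^ n * y ^ n
  *-^ x y zero    = sym (*-identityˡ _)
  *-^ x y (suc n) = trans (cong ((x * y) *_) (*-^ x y n))
    (solve 4 (λ x y u v → (x :* y) :* (u :* v) := (x :* u) :* (y :* v)) refl x y (x ^ n) (y ^ n))

  1^ : ∀ n → 1# ^ n ≡ 1#
  1^ zero    = refl
  1^ (suc n) = trans (*-identityˡ _) (1^ n)

  ^-* : ∀ x m n → x ^ (m ℕ.* n) ≡ (x ^ m) ^ n
  ^-* x zero    n = sym (1^ n)
  ^-* x (suc m) n = begin
    x ^ (n ℕ.+ m ℕ.* n)       ≡⟨ ^-+ x n (m ℕ.* n) ⟩
    x ^ n * x ^ (m ℕ.* n)     ≡⟨ cong (x ^ n *_) (^-* x m n) ⟩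
    x ^ n * (x ^ m) ^ n       ≡⟨ *-^ x (x ^ m) n ⟨
    (x * x ^ m) ^ n           ∎
    where open ≡-Reasoning

  x^n≡0⇒x≡0 : ∀ {x} n → x ^ n ≡ 0# → x ≡ 0#
  x^n≡0⇒x≡0 zero    1≡0 = ⊥-elim (0≢1 (sym 1≡0))
  x^n≡0⇒x≡0 {x} (suc n) x^n≡0 with x*y≡0⇒x≡0⊎y≡0 x (x ^ n) x^n≡0
  ... | inj₁ x≡0   = x≡0
  ... | inj₂ x^n≡0 = x^n≡0⇒x≡0 n x^n≡0

  card-nonZero : ∃[ m ] card ≡ suc m
  card-nonZero = nonEmpty (from 0#)
    where
    nonEmpty : ∀ {n} → Fin n → ∃[ m ] n ≡ suc m
    nonEmpty {suc m} _ = m , refl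

  injective⇒surjective : (f : Carrier → Carrier) → (∀ x y → f x ≡ f y → x ≡ y) → ∀ y → ∃[ x ] f x ≡ y
  injective⇒surjective f inj y with Fin-injective⇒surjective (from ∘ f ∘ to) fin-inj (from y)
    where
    fin-inj : ∀ i j → from (f (to i)) ≡ from (f (to j)) → i ≡ j
    fin-inj i j e = to-injective i j (inj _ _ (from-injective _ _ e))
  ... | i , e = to i , from-injective _ _ e

  module ∑ (M : CommutativeMonoid 0ℓ 0ℓ) where
    open CommutativeMonoid M using (_≈_; _∙_; ε; ∙-congˡ; identityʳ) renaming (Carrier to A; trans to ≈-trans; reflexive to ≈-reflexive)
    open import Algebra.Properties.CommutativeMonoid.Sum M public
      using (sum; sum-permute; sum-cong-≗; sum-cong-≋; ∑-distrib-+; sum-replicate; sum-remove; sum-replicate-zero)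

    ∑ : (Carrier → A) → A
    ∑ F = sum (F ∘ to)

    ∑-reindex : ∀ F (σ τ : Carrier → Carrier) → (∀ y → σ (τ y) ≡ y) → (∀ y → τ (σ y) ≡ y) → ∑ F ≈ ∑ (F ∘ σ)
    ∑-reindex F σ τ στ τσ = ≈-trans (sum-permute (F ∘ to) π)
      (≈-reflexive (sum-cong-≗ (λ i → cong F (strictlyInverseˡ (σ (to i))))))
      where
      π : Permutation card card
      π = mk↔ₛ′ (from ∘ σ ∘ to) (from ∘ τ ∘ to)
        (λ i → trans (cong (from ∘ σ) (strictlyInverseˡ _)) (trans (cong from (στ _)) (strictlyInverseʳ i)))
        (λ i → trans (cong (from ∘ τ) (strictlyInverseˡ _)) (trans (cong from (τσ _)) (strictlyInverseʳ i)))

    sum-single : ∀ {n} (u : Fin n → A) j → (∀ i → i ≢ j → u i ≈ ε) → sum u ≈ u j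
    sum-single {suc n} u j others≈ε = ≈-trans (sum-remove u) (≈-trans (∙-congˡ rest≈ε) (identityʳ (u j)))
      where
      rest≈ε : sum (u ∘ Fin.punchIn j) ≈ ε
      rest≈ε = ≈-trans (sum-cong-≋ {x = u ∘ Fin.punchIn j} {y = replicate n ε}
                          (λ i → others≈ε _ (Fin.punchInᵢ≢i j i)))
                        (sum-replicate-zero n)

  open import Algebra.Properties.Semiring.Mult semiring public using () renaming (_×_ to _·_)
  module Σ+ = ∑ +-commutativeMonoid
  module Π* = ∑ *-commutativeMonoid

  card·1≡0 : card · 1# ≡ 0#
  card·1≡0 = +-identityʳ-unique (Σ+.∑ id) (card · 1#) (begin
    Σ+.∑ id + card · 1#          ≡⟨ +-comm _ _ ⟩
    card · 1# + Σ+.∑ id          ≡⟨ cong (_+ Σ+.∑ id) (Σ+.sum-replicate card) ⟨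
    Σ+.∑ (λ _ → 1#) + Σ+.∑ id    ≡⟨ Σ+.∑-distrib-+ (λ _ → 1#) to ⟨
    Σ+.∑ (1# +_)                 ≡⟨ Σ+.∑-reindex id (1# +_) (- 1# +_) (solve 2 (λ a y → a :+ (:- a :+ y) := y) refl 1#)
                                                    (solve 2 (λ a y → :- a :+ (a :+ y) := y) refl 1#) ⟨
    Σ+.∑ id                      ∎)
    where open ≡-Reasoning

  *-cancelʳ-≢0 : ∀ {z} x y → z ≢ 0# → x * z ≡ y * z → x ≡ y
  *-cancelʳ-≢0 {z} x y z≢0 xz≡yz = begin
    x                ≡⟨ y≡x⁻¹[xy] x z≢0 ⟩
    z ⁻¹ * (z * x)   ≡⟨ cong (z ⁻¹ *_) (trans (*-comm z x) (trans xz≡yz (*-comm y z))) ⟩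
    z ⁻¹ * (z * y)   ≡⟨ y≡x⁻¹[xy] y z≢0 ⟨
    y                ∎
    where open ≡-Reasoning

  ∏≢0 : ∀ {m} (u : Fin m → Carrier) → (∀ i → u i ≢ 0#) → Π*.sum u ≢ 0#
  ∏≢0 {zero}  u _   1≡0 = 0≢1 (sym 1≡0)
  ∏≢0 {suc m} u u≢0 = x≢0∧y≢0⇒x*y≢0 (u≢0 Fin.zero) (∏≢0 (u ∘ Fin.suc) (u≢0 ∘ Fin.suc))

  open import Algebra.Properties.Semiring.Exp semiring public using () renaming (_^_ to _^ₛ_)

  ^≡^ₛ : ∀ x n → x ^ n ≡ x ^ₛ n
  ^≡^ₛ x zero    = refl
  ^≡^ₛ x (suc n) = cong (x *_) (^≡^ₛ x n)

  ν : Carrier → Carrier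
  ν y with y ≟ 0#
  ... | yes _ = 1#
  ... | no _  = y

  δ : Carrier → Carrier → Carrier
  δ a y with y ≟ 0#
  ... | yes _ = a
  ... | no _  = 1#

  ∏ν≢0 : Π*.∑ ν ≢ 0#
  ∏ν≢0 = ∏≢0 (ν ∘ to) (λ i → ν≢0 (to i))
    where
    ν≢0 : ∀ y → ν y ≢ 0#
    ν≢0 y with y ≟ 0#
    ... | yes _  = λ 1≡0 → 0≢1 (sym 1≡0)
    ... | no y≢0 = y≢0

  a*νy≡ν[ay]*δay : ∀ {a} → a ≢ 0# → ∀ y → a * ν y ≡ ν (a * y) * δ a y
  a*νy≡ν[ay]*δay {a} a≢0 y with y ≟ 0# | a * y ≟ 0#
  ... | yes _    | yes _     = trans (*-identityʳ a) (sym (*-identityˡ a))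
  ... | yes refl | no ay≢0   = ⊥-elim (ay≢0 (zeroʳ a))
  ... | no y≢0   | yes ay≡0  = ⊥-elim (x≢0∧y≢0⇒x*y≢0 a≢0 y≢0 ay≡0)
  ... | no _     | no _      = sym (*-identityʳ _)

  ∏δ≡a : ∀ a → Π*.∑ (δ a) ≡ a
  ∏δ≡a a = trans (Π*.sum-single (δ a ∘ to) (from 0#) δ≡1) (δ0≡a (to (from 0#)) (strictlyInverseˡ 0#))
    where
    δ0≡a : ∀ y → y ≡ 0# → δ a y ≡ a
    δ0≡a y y≡0 with y ≟ 0#
    ... | yes _  = refl
    ... | no y≢0 = ⊥-elim (y≢0 y≡0)
    δ≡1 : ∀ i → i ≢ from 0# → δ a (to i) ≡ 1#
    δ≡1 i i≢ with to i ≟ 0#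
    ... | yes toi≡0 = ⊥-elim (i≢ (trans (sym (strictlyInverseʳ i)) (cong from toi≡0)))
    ... | no _      = refl

  -- Fermat: y ↦ x * y permutes K, so the products over K of the two sides of
  -- a*νy≡ν[ay]*δay give x ^ card * ∏ ν ≡ ∏ ν * x.
  x^card≡x : ∀ x → x ^ card ≡ x
  x^card≡x x with x ≟ 0# | card-nonZero
  ... | yes refl | m , card≡1+m rewrite card≡1+m = zeroˡ _
  ... | no x≢0   | _ = *-cancelʳ-≢0 (x ^ card) x ∏ν≢0 (begin
    x ^ card * ∏ν                       ≡⟨ cong (_* ∏ν) (trans (^≡^ₛ x card) (sym (Π*.sum-replicate card))) ⟩
    Π*.∑ (λ _ → x) * ∏ν                 ≡⟨ Π*.∑-distrib-+ (λ _ → x) (ν ∘ to) ⟨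
    Π*.∑ (λ y → x * ν y)                ≡⟨ Π*.sum-cong-≗ (a*νy≡ν[ay]*δay x≢0 ∘ to) ⟩
    Π*.∑ (λ y → ν (x * y) * δ x y)      ≡⟨ Π*.∑-distrib-+ (ν ∘ (x *_) ∘ to) (δ x ∘ to) ⟩
    Π*.∑ (ν ∘ (x *_)) * Π*.∑ (δ x)      ≡⟨ cong₂ _*_ (sym (Π*.∑-reindex ν (x *_) (x ⁻¹ *_) x[x⁻¹y]≡y x⁻¹[xy]≡y)) (∏δ≡a x) ⟩
    ∏ν * x                              ≡⟨ *-comm ∏ν x ⟩
    x * ∏ν                              ∎)
    where
    open ≡-Reasoning
    ∏ν = Π*.∑ ν
    x[x⁻¹y]≡y : ∀ y → x * (x ⁻¹ * y) ≡ y
    x[x⁻¹y]≡y y = trans (sym (*-assoc _ _ _)) (trans (cong (_* y) (⁻¹-inverse x x≢0)) (*-identityˡ y))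
    x⁻¹[xy]≡y : ∀ y → x ⁻¹ * (x * y) ≡ y
    x⁻¹[xy]≡y y = sym (y≡x⁻¹[xy] y x≢0)

  -- Extend f by the identity outside P to an injective self-map of K.
  injectiveOn⇒surjectiveOn : (P : Carrier → Set) → (∀ x → Dec (P x)) → (f : Carrier → Carrier) →
    (∀ x → P x → P (f x)) → (∀ x y → P x → P y → f x ≡ f y → x ≡ y) →
    ∀ y → P y → Σ Carrier λ x → P x × f x ≡ y
  injectiveOn⇒surjectiveOn P P? f f-into f-inj y Py with injective⇒surjective F F-inj y
    where
    F : Carrier → Carrier
    F x with P? x
    ... | yes _ = f x
    ... | no _  = x
    F-inj : ∀ x y → F x ≡ F y → x ≡ y
    F-inj x y Fx≡Fy with P? x | P? y
    ... | yes Px | yes Py  = f-inj x y Px Py Fx≡Fy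
    ... | yes Px | no ¬Py  = ⊥-elim (¬Py (subst P Fx≡Fy (f-into x Px)))
    ... | no ¬Px | yes Py  = ⊥-elim (¬Px (subst P (sym Fx≡Fy) (f-into y Py)))
    ... | no _   | no _    = Fx≡Fy
  ... | x , Fx≡y with P? x
  ...   | yes Px = x , Px , Fx≡y
  ...   | no ¬Px = ⊥-elim (¬Px (subst P (sym Fx≡y) Py))

  /-difference : ∀ {u v} c → u ≢ 0# → v ≢ 0# → c / v + - (c / u) ≡ (u + - v) * (c / (u * v))
  /-difference {u} {v} c u≢0 v≢0 = sym (begin
    (u + - v) * (c * (u * v) ⁻¹)                    ≡⟨ cong (λ w → (u + - v) * (c * w)) (⁻¹-distrib-* u≢0 v≢0) ⟩
    (u + - v) * (c * (u ⁻¹ * v ⁻¹))                 ≡⟨ solve 5 (λ u v c u′ v′ → (u :- v) :* (c :* (u′ :* v′)) := c :* ((u :* u′) :* v′) :- c :* ((v :* v′) :* u′)) refl u v c (u ⁻¹) (v ⁻¹) ⟩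
    c * ((u * u ⁻¹) * v ⁻¹) + - (c * ((v * v ⁻¹) * u ⁻¹))
      ≡⟨ cong₂ (λ s t → c * (s * v ⁻¹) + - (c * (t * u ⁻¹))) (⁻¹-inverse u u≢0) (⁻¹-inverse v v≢0) ⟩
    c * (1# * v ⁻¹) + - (c * (1# * u ⁻¹))           ≡⟨ cong₂ (λ s t → c * s + - (c * t)) (*-identityˡ _) (*-identityˡ _) ⟩
    c / v + - (c / u)                               ∎)
    where open ≡-Reasoning

  injective⇒bijective : (f : Carrier → Carrier) → (∀ x y → f x ≡ f y → x ≡ y) → Bijective _≡_ _≡_ f
  injective⇒bijective f f-inj = (λ {x} {y} → f-inj x y) , surjective
    where
    surjective : ∀ y → ∃[ x ] (∀ {z} → z ≡ x → f z ≡ y)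
    surjective y with injective⇒surjective f f-inj y
    ... | x , fx≡y = x , λ { refl → fx≡y }

module PolynomialFunctions (K : FiniteField) where
  open FiniteField K
  open FiniteFieldProperties K

  -- IsPolynomial d l h: h is a polynomial function of degree at most d
  -- whose coefficient of x ^ d is l, given in Horner form.
  data IsPolynomial : ℕ → Carrier → (Carrier → Carrier) → Set where
    constant : ∀ {a h} → (∀ x → h x ≡ a) → IsPolynomial 0 a h
    horner   : ∀ {d l h h′} a → IsPolynomial d l h′ → (∀ x → h x ≡ x * h′ x + a) → IsPolynomial (suc d) l h

  IsPolynomial-raise : ∀ {d l h} → IsPolynomial d l h → IsPolynomial (suc d) 0# h
  IsPolynomial-raise (constant {a} h≡a) = horner a (constant (λ _ → refl))
    (λ x → trans (h≡a x) (trans (sym (+-identityˡ a)) (cong (_+ a) (sym (zeroʳ x)))))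
  IsPolynomial-raise (horner a p h≡) = horner a (IsPolynomial-raise p) h≡

  IsPolynomial-lift : ∀ {d e l h} → d ℕ.< e → IsPolynomial d l h → IsPolynomial e 0# h
  IsPolynomial-lift {d} {suc e} d<1+e p with ℕ.m<1+n⇒m<n∨m≡n d<1+e
  ... | inj₁ d<e  = IsPolynomial-raise (IsPolynomial-lift d<e p)
  ... | inj₂ refl = IsPolynomial-raise p

  IsPolynomial-+ : ∀ {d l m u v} → IsPolynomial d l u → IsPolynomial d m v → IsPolynomial d (l + m) (λ x → u x + v x)
  IsPolynomial-+ (constant u≡) (constant v≡) = constant (λ x → cong₂ _+_ (u≡ x) (v≡ x))
  IsPolynomial-+ (horner {h′ = u′} a p u≡) (horner {h′ = v′} b r v≡) = horner (a + b) (IsPolynomial-+ p r)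
    (λ x → trans (cong₂ _+_ (u≡ x) (v≡ x))
       (solve 5 (λ x u a v b → (x :* u :+ a) :+ (x :* v :+ b) := x :* (u :+ v) :+ (a :+ b)) refl x (u′ x) a (v′ x) b))

  IsPolynomial-* : ∀ {d l u} r → IsPolynomial d l u → IsPolynomial d (r * l) (λ x → r * u x)
  IsPolynomial-* r (constant u≡) = constant (λ x → cong (r *_) (u≡ x))
  IsPolynomial-* r (horner {h′ = u′} a p u≡) = horner (r * a) (IsPolynomial-* r p)
    (λ x → trans (cong (r *_) (u≡ x))
       (solve 4 (λ r x u a → r :* (x :* u :+ a) := x :* (r :* u) :+ r :* a) refl r x (u′ x) a))

  IsPolynomial-^ : ∀ e → IsPolynomial e 1# (_^ e)
  IsPolynomial-^ zero    = constant (λ _ → refl)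
  IsPolynomial-^ (suc e) = horner 0# (IsPolynomial-^ e) (λ x → sym (+-identityʳ _))

  factor-theorem : ∀ {d l h} → IsPolynomial (suc d) l h → ∀ r →
                   Σ (Carrier → Carrier) λ h′ → IsPolynomial d l h′ × (∀ x → h x + - h r ≡ (x + - r) * h′ x)
  factor-theorem {h = h} (horner {h′ = h₁} a (constant {l} h₁≡l) h≡) r = h₁ , constant h₁≡l , λ x → begin
    h x + - h r                           ≡⟨ cong₂ (λ u v → u + - v) (h≡ x) (h≡ r) ⟩
    (x * h₁ x + a) + - (r * h₁ r + a)     ≡⟨ cong₂ (λ u v → (x * u + a) + - (r * v + a)) (h₁≡l x) (h₁≡l r) ⟩
    (x * l + a) + - (r * l + a)           ≡⟨ solve 4 (λ x r l a → (x :* l :+ a) :- (r :* l :+ a) := (x :- r) :* l) refl x r l a ⟩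
    (x + - r) * l                         ≡⟨ cong ((x + - r) *_) (h₁≡l x) ⟨
    (x + - r) * h₁ x                      ∎
    where open ≡-Reasoning
  factor-theorem {suc d} {l} {h} (horner {h′ = h₁} a p@(horner _ _ _) h≡) r with factor-theorem p r
  ... | h₂ , p₂ , h₁-factor = h′ , subst (λ l′ → IsPolynomial (suc d) l′ h′) (+-identityʳ l) (IsPolynomial-+ p (IsPolynomial-raise (IsPolynomial-* r p₂))) , λ x → begin
    h x + - h r                             ≡⟨ cong₂ (λ u v → u + - v) (h≡ x) (h≡ r) ⟩
    (x * h₁ x + a) + - (r * h₁ r + a)       ≡⟨ solve 5 (λ x r u v a → (x :* u :+ a) :- (r :* v :+ a) := (x :- r) :* u :+ r :* (u :- v)) refl x r (h₁ x) (h₁ r) a ⟩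
    (x + - r) * h₁ x + r * (h₁ x + - h₁ r)  ≡⟨ cong (λ z → (x + - r) * h₁ x + r * z) (h₁-factor x) ⟩
    (x + - r) * h₁ x + r * ((x + - r) * h₂ x) ≡⟨ solve 4 (λ x r u w → (x :- r) :* u :+ r :* ((x :- r) :* w) := (x :- r) :* (u :+ r :* w)) refl x r (h₁ x) (h₂ x) ⟩
    (x + - r) * h′ x                          ∎
    where
    open ≡-Reasoning
    h′ : Carrier → Carrier
    h′ x = h₁ x + r * h₂ x

  roots⇒leading≡0 : ∀ {d l h} → IsPolynomial d l h → (v : Fin (suc d) → Carrier) →
                    (∀ i j → v i ≡ v j → i ≡ j) → (∀ i → h (v i) ≡ 0#) → l ≡ 0#
  roots⇒leading≡0 (constant h≡l) v _ roots = trans (sym (h≡l (v Fin.zero))) (roots Fin.zero)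
  roots⇒leading≡0 {h = h} p@(horner _ _ _) v v-inj roots with factor-theorem p (v Fin.zero)
  ... | h′ , p′ , factor = roots⇒leading≡0 p′ (λ i → v (Fin.suc i)) (λ i j e → Fin.suc-injective (v-inj _ _ e)) h′-roots
    where
    h′-roots : ∀ i → h′ (v (Fin.suc i)) ≡ 0#
    h′-roots i = x≢0⇒x*y≡0⇒y≡0 (λ d≡0 → Fin.0≢1+n (sym (v-inj _ _ (x-y≡0⇒x≡y _ _ d≡0)))) (begin
      (v (Fin.suc i) + - v Fin.zero) * h′ (v (Fin.suc i))   ≡⟨ factor (v (Fin.suc i)) ⟨
      h (v (Fin.suc i)) + - h (v Fin.zero)                 ≡⟨ cong₂ (λ u w → u + - w) (roots (Fin.suc i)) (roots Fin.zero) ⟩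
      0# + - 0#                                            ≡⟨ -‿inverseʳ 0# ⟩
      0#                                                   ∎)
      where open ≡-Reasoning

prime∤! : ∀ {p m} → Prime p → m < p → ¬ p ∣ m !
prime∤! {p} {zero}  pp _   p∣1 = ℕ.<-irrefl (sym (∣1⇒≡1 p∣1)) (ℕ.nonTrivial⇒n>1 p {{prime⇒nonTrivial pp}})
prime∤! {p} {suc m} pp m<p p∣m! with euclidsLemma (suc m) (m !) pp p∣m!
... | inj₁ p∣1+m = ℕ.<-irrefl refl (ℕ.<-≤-trans m<p (∣⇒≤ p∣1+m))
... | inj₂ p∣m!  = prime∤! pp (ℕ.<-trans (ℕ.n<1+n m) m<p) p∣m!

prime∣C : ∀ {p j} → Prime p → 0 < j → j < p → p ∣ p C j
prime∣C {p@(suc p′)} {j} pp 0<j j<p with euclidsLemma (j ! ℕ.* (p ℕ.∸ j) !) (p C j) pp p∣j![p-j]!C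
  where
  open import Data.Nat.Properties using (_!*_!≢0)
  j![p-j]!C≡p! : (j ! ℕ.* (p ℕ.∸ j) !) ℕ.* (p C j) ≡ p !
  j![p-j]!C≡p! = trans (cong ((j ! ℕ.* (p ℕ.∸ j) !) ℕ.*_) (nCk≡n!/k![n-k]! (ℕ.<⇒≤ j<p)))
                       (m*[n/m]≡n {{j !* (p ℕ.∸ j) !≢0}} (k![n∸k]!∣n! (ℕ.<⇒≤ j<p)))
  p∣j![p-j]!C : p ∣ (j ! ℕ.* (p ℕ.∸ j) !) ℕ.* (p C j)
  p∣j![p-j]!C = subst (p ∣_) (sym j![p-j]!C≡p!) (m∣m*n (p′ !))
... | inj₂ p∣C = p∣C
... | inj₁ p∣j![p-j]! with euclidsLemma (j !) ((p ℕ.∸ j) !) pp p∣j![p-j]!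
...   | inj₁ p∣j!     = ⊥-elim (prime∤! pp j<p p∣j!)
...   | inj₂ p∣[p-j]! = ⊥-elim (prime∤! pp (ℕ.∸-monoʳ-< 0<j (ℕ.<⇒≤ j<p)) p∣[p-j]!)

module Frobenius (K : FiniteField) where
  open FiniteField K
  open FiniteFieldProperties K
  open import Algebra.Properties.Semiring.Mult semiring using (×-assocˡ; ×-assoc-*; ×1-homo-*)
  open import Algebra.Properties.Semiring.Sum semiring using (sum; sum-init-last; sum-cong-≋; sum-replicate-zero)
  open import Data.Vec.Functional using (init; tail)
  open import Data.Fin.Patterns using (0F)

  AdditivePower : ℕ → Set
  AdditivePower e = ∀ x y → (x + y) ^ e ≡ x ^ e + y ^ e

  ∣⇒·≡0 : ∀ {p n} z → p · 1# ≡ 0# → p ∣ n → n · z ≡ 0#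
  ∣⇒·≡0 {p} z p·1≡0 (divides d refl) = begin
    (d ℕ.* p) · z      ≡⟨ cong (_· z) (ℕ.*-comm d p) ⟩
    (p ℕ.* d) · z      ≡⟨ ×-assocˡ z p d ⟨
    p · (d · z)        ≡⟨ cong (p ·_) (*-identityˡ (d · z)) ⟨
    p · (1# * d · z)   ≡⟨ ×-assoc-* p 1# (d · z) ⟨
    (p · 1#) * d · z   ≡⟨ cong (_* d · z) p·1≡0 ⟩
    0# * d · z         ≡⟨ zeroˡ _ ⟩
    0#                 ∎
    where open ≡-Reasoning

  -- In the binomial expansion of (x + y) ^ p all terms but x ^ p and y ^ p
  -- carry a binomial coefficient divisible by p.
  prime-additivePower : ∀ {p} → Prime p → p · 1# ≡ 0# → AdditivePower p
  prime-additivePower {p@(suc (suc m))} pp p·1≡0 x y = begin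
    (x + y) ^ p                                   ≡⟨ ^≡^ₛ (x + y) p ⟩
    (x + y) ^ₛ p                                  ≡⟨ B.theorem (*-comm x y) p ⟩
    t 0F + sum (tail t)                           ≡⟨ cong (t 0F +_) (sum-init-last (tail t)) ⟩
    t 0F + (sum (init (tail t)) + t (Fin.fromℕ p)) ≡⟨ cong₂ (λ u v → u + (v + t (Fin.fromℕ p))) first≡y^p middle≡0 ⟩
    y ^ p + (0# + t (Fin.fromℕ p))                ≡⟨ cong (y ^ p +_) (trans (+-identityˡ _) last≡x^p) ⟩
    y ^ p + x ^ p                                 ≡⟨ +-comm _ _ ⟩
    x ^ p + y ^ p                                 ∎
    where
    open ≡-Reasoning
    module B = Binomial semiring x y
    t = B.binomialTerm p
    first≡y^p : t 0F ≡ y ^ p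
    first≡y^p = trans (+-identityʳ _) (trans (*-identityˡ _) (sym (^≡^ₛ y p)))
    last≡x^p : t (Fin.fromℕ p) ≡ x ^ p
    last≡x^p rewrite Fin.toℕ-fromℕ m | nCn≡1 p | ℕ.n∸n≡0 m =
      trans (+-identityʳ _) (trans (*-identityʳ _) (sym (^≡^ₛ x p)))
    middle≡0 : sum (init (tail t)) ≡ 0#
    middle≡0 = trans (sum-cong-≋ {y = replicate (suc m) 0#} (λ i → ∣⇒·≡0 (B.binomial p (Fin.suc (Fin.inject₁ i))) p·1≡0 (p∣C i))) (sum-replicate-zero (suc m))
      where
      p∣C : ∀ (i : Fin (suc m)) → p ∣ p C suc (Fin.toℕ (Fin.inject₁ i))
      p∣C i = prime∣C pp (s≤s z≤n) (s≤s (subst (ℕ._< suc m) (sym (Fin.toℕ-inject₁ i)) (Fin.toℕ<n i)))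

  AdditivePower-1 : AdditivePower 1
  AdditivePower-1 x y = trans (*-identityʳ _) (cong₂ _+_ (sym (*-identityʳ x)) (sym (*-identityʳ y)))

  AdditivePower-* : ∀ {a b} → AdditivePower a → AdditivePower b → AdditivePower (a ℕ.* b)
  AdditivePower-* {a} {b} +-^a +-^b x y = begin
    (x + y) ^ (a ℕ.* b)               ≡⟨ ^-* (x + y) a b ⟩
    ((x + y) ^ a) ^ b                 ≡⟨ cong (_^ b) (+-^a x y) ⟩
    (x ^ a + y ^ a) ^ b               ≡⟨ +-^b (x ^ a) (y ^ a) ⟩
    (x ^ a) ^ b + (y ^ a) ^ b         ≡⟨ cong₂ _+_ (^-* x a b) (^-* y a b) ⟨
    x ^ (a ℕ.* b) + y ^ (a ℕ.* b)     ∎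
    where open ≡-Reasoning

  AdditivePower-^ : ∀ {a} → AdditivePower a → ∀ j → AdditivePower (a ℕ.^ j)
  AdditivePower-^ +-^a zero    = AdditivePower-1
  AdditivePower-^ {a} +-^a (suc j) = AdditivePower-* {a} {a ℕ.^ j} +-^a (AdditivePower-^ +-^a j)

  AdditivePower-0# : ∀ {e} → AdditivePower e → 0# ^ e ≡ 0#
  AdditivePower-0# {e} +-^e = x+x≈x⇒x≈0 (0# ^ e) (trans (sym (+-^e 0# 0#)) (cong (_^ e) (+-identityʳ 0#)))

  AdditivePower-neg : ∀ {e} → AdditivePower e → ∀ x → (- x) ^ e ≡ - (x ^ e)
  AdditivePower-neg {e} +-^e x = +-inverseʳ-unique (x ^ e) ((- x) ^ e)
    (trans (sym (+-^e x (- x))) (trans (cong (_^ e) (-‿inverseʳ x)) (AdditivePower-0# {e} +-^e)))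

  ·1-homo-^ : ∀ m j → (m ℕ.^ j) · 1# ≡ (m · 1#) ^ j
  ·1-homo-^ m zero    = +-identityʳ 1#
  ·1-homo-^ m (suc j) = trans (×1-homo-* m (m ℕ.^ j)) (cong ((m · 1#) *_) (·1-homo-^ m j))

  card≡p^j⇒p·1≡0 : ∀ {p j} → card ≡ p ℕ.^ j → p · 1# ≡ 0#
  card≡p^j⇒p·1≡0 {p} {j} card≡p^j = x^n≡0⇒x≡0 j (trans (sym (·1-homo-^ p j)) (trans (cong (_· 1#) (sym card≡p^j)) card·1≡0))

module SubfieldTrace (K : FiniteField) (q n : ℕ) {p k : ℕ} (p-prime : Prime p) (0<k : 0 < k)
                     (q≡p^k : q ≡ p ℕ.^ k) (card≡q^n : FiniteField.card K ≡ q ℕ.^ n) where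
  open FiniteField K
  open FieldExt K q n
  open FiniteFieldProperties K
  open Frobenius K

  AdditivePower-p : AdditivePower p
  AdditivePower-p = prime-additivePower p-prime (card≡p^j⇒p·1≡0 {p} {k ℕ.* n} card≡p^[kn])
    where
    card≡p^[kn] : card ≡ p ℕ.^ (k ℕ.* n)
    card≡p^[kn] = trans card≡q^n (trans (cong (ℕ._^ n) q≡p^k) (ℕ.^-*-assoc p k n))

  AdditivePower-q^ : ∀ i → AdditivePower (q ℕ.^ i)
  AdditivePower-q^ = AdditivePower-^ {q} (subst AdditivePower (sym q≡p^k) (AdditivePower-^ {p} AdditivePower-p k))

  AdditivePower-q : AdditivePower q
  AdditivePower-q = subst AdditivePower (ℕ.*-identityʳ q) (AdditivePower-q^ 1)

  InFq-+ : ∀ {x y} → InFq x → InFq y → InFq (x + y)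
  InFq-+ {x} {y} x^q≡x y^q≡y = trans (AdditivePower-q x y) (cong₂ _+_ x^q≡x y^q≡y)

  InFq-neg : ∀ {x} → InFq x → InFq (- x)
  InFq-neg {x} x^q≡x = trans (AdditivePower-neg {q} AdditivePower-q x) (cong -_ x^q≡x)

  InFq-* : ∀ {x y} → InFq x → InFq y → InFq (x * y)
  InFq-* {x} {y} x^q≡x y^q≡y = trans (*-^ x y q) (cong₂ _*_ x^q≡x y^q≡y)

  InFq-⁻¹ : ∀ {x} → x ≢ 0# → InFq x → InFq (x ⁻¹)
  InFq-⁻¹ {x} x≢0 x^q≡x = ⁻¹-unique x _ (begin
    x * (x ⁻¹) ^ q          ≡⟨ cong (_* (x ⁻¹) ^ q) x^q≡x ⟨
    x ^ q * (x ⁻¹) ^ q      ≡⟨ *-^ x (x ⁻¹) q ⟨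
    (x * x ⁻¹) ^ q          ≡⟨ cong (_^ q) (⁻¹-inverse x x≢0) ⟩
    1# ^ q                  ≡⟨ 1^ q ⟩
    1#                      ∎)
    where open ≡-Reasoning

  InFq-^q^ : ∀ {x} → InFq x → ∀ i → x ^ (q ℕ.^ i) ≡ x
  InFq-^q^ {x} x^q≡x zero    = *-identityʳ x
  InFq-^q^ {x} x^q≡x (suc i) = trans (^-* x q (q ℕ.^ i)) (trans (cong (_^ (q ℕ.^ i)) x^q≡x) (InFq-^q^ x^q≡x i))

  traceSum-+ : ∀ m x y → traceSum m (x + y) ≡ traceSum m x + traceSum m y
  traceSum-+ zero    x y = sym (+-identityˡ 0#)
  traceSum-+ (suc m) x y = trans (cong₂ _+_ (traceSum-+ m x y) (AdditivePower-q^ m x y)) (interchange _ _ _ _)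

  traceSum-neg : ∀ m x → traceSum m (- x) ≡ - traceSum m x
  traceSum-neg zero    x = sym -0#≈0#
  traceSum-neg (suc m) x = trans (cong₂ _+_ (traceSum-neg m x) (AdditivePower-neg {q ℕ.^ m} (AdditivePower-q^ m) x)) (-‿+-comm _ _)

  traceSum-* : ∀ m {a} x → InFq a → traceSum m (a * x) ≡ a * traceSum m x
  traceSum-* zero    {a} x _     = sym (zeroʳ a)
  traceSum-* (suc m) {a} x a∈Fq = trans (cong₂ _+_ (traceSum-* m x a∈Fq) a[x^q^m])
                                       (sym (distribˡ a _ _))
    where
    a[x^q^m] : (a * x) ^ (q ℕ.^ m) ≡ a * x ^ (q ℕ.^ m)
    a[x^q^m] = trans (*-^ a x (q ℕ.^ m)) (cong (_* x ^ (q ℕ.^ m)) (InFq-^q^ a∈Fq m))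

  Tr-sub : ∀ x y → Tr (x + - y) ≡ Tr x + - Tr y
  Tr-sub x y = trans (traceSum-+ n x (- y)) (cong (Tr x +_) (traceSum-neg n y))

  traceSum-^q : ∀ m x → traceSum m x ^ q + x ≡ traceSum m x + x ^ (q ℕ.^ m)
  traceSum-^q zero    x = trans (cong (_+ x) (AdditivePower-0# {q} AdditivePower-q))
                            (trans (+-identityˡ x) (trans (sym (*-identityʳ x)) (sym (+-identityˡ _))))
  traceSum-^q (suc m) x = begin
    (T + x ^ Q) ^ q + x              ≡⟨ cong (_+ x) (AdditivePower-q T (x ^ Q)) ⟩
    (T ^ q + (x ^ Q) ^ q) + x        ≡⟨ solve 3 (λ a b c → (a :+ b) :+ c := (a :+ c) :+ b) refl (T ^ q) ((x ^ Q) ^ q) x ⟩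
    (T ^ q + x) + (x ^ Q) ^ q        ≡⟨ cong₂ _+_ (traceSum-^q m x) (sym (trans (cong (x ^_) (ℕ.*-comm q Q)) (^-* x Q q))) ⟩
    (T + x ^ Q) + x ^ (q ℕ.* Q)      ∎
    where
    open ≡-Reasoning
    T = traceSum m x
    Q = q ℕ.^ m

  Tr-InFq : ∀ x → InFq (Tr x)
  Tr-InFq x = +-cancelʳ x _ _ (begin
    Tr x ^ q + x             ≡⟨ traceSum-^q n x ⟩
    Tr x + x ^ (q ℕ.^ n)     ≡⟨ cong (λ e → Tr x + x ^ e) card≡q^n ⟨
    Tr x + x ^ card          ≡⟨ cong (Tr x +_) (x^card≡x x) ⟩
    Tr x + x                 ∎)
    where open ≡-Reasoning

  open PolynomialFunctions K

  1<q : 1 < q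
  1<q = subst (1 <_) (sym q≡p^k) (ℕ.^-monoʳ-< p (ℕ.nonTrivial⇒n>1 p {{prime⇒nonTrivial p-prime}}) 0<k)

  traceSum-isPolynomial : ∀ m → IsPolynomial (q ℕ.^ m) 1# (traceSum (suc m))
  traceSum-isPolynomial zero    = horner 0# (constant (λ _ → refl)) (λ x → +-comm _ _)
  traceSum-isPolynomial (suc m) = subst (λ l → IsPolynomial (q ℕ.^ suc m) l (traceSum (suc (suc m)))) (+-identityˡ 1#)
    (IsPolynomial-+ (IsPolynomial-lift (ℕ.^-monoʳ-< q 1<q (ℕ.n<1+n m)) (traceSum-isPolynomial m))
                    (IsPolynomial-^ (q ℕ.^ suc m)))

  -- A nonzero polynomial of degree q ^ m has fewer than card = q ^ (m + 1) roots.
  traceSum-nonzero : ∀ m → card ≡ q ℕ.^ suc m → ∃[ w ] traceSum (suc m) w ≢ 0#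
  traceSum-nonzero m card≡q^[1+m] with Fin.¬∀⟶∃¬ card (λ i → traceSum (suc m) (to i) ≡ 0#) (λ i → traceSum (suc m) (to i) ≟ 0#) not-all-roots
    where
    open Inverse enum using (to)
    q^m<card : suc (q ℕ.^ m) ℕ.≤ card
    q^m<card = subst (q ℕ.^ m <_) (sym card≡q^[1+m]) (ℕ.^-monoʳ-< q 1<q (ℕ.n<1+n m))
    not-all-roots : ¬ (∀ i → traceSum (suc m) (to i) ≡ 0#)
    not-all-roots all-roots = 0≢1 (sym (roots⇒leading≡0 (traceSum-isPolynomial m)
      (λ i → to (Fin.inject≤ i q^m<card))
      (λ i j e → Fin.inject≤-injective q^m<card q^m<card i j (to-injective _ _ e))
      (λ i → all-roots (Fin.inject≤ i q^m<card))))
  ... | i , Tr≢0 = Inverse.to enum i , Tr≢0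

  Tr-nonzero : 0 < n → ∃[ w ] Tr w ≢ 0#
  Tr-nonzero 0<n with ℕ.m≤n⇒∃[o]m+o≡n 0<n
  ... | m , 1+m≡n = subst (λ n′ → ∃[ w ] traceSum n′ w ≢ 0#) 1+m≡n
                      (traceSum-nonzero m (subst (λ n′ → card ≡ q ℕ.^ n′) (sym 1+m≡n) card≡q^n))

  Tr-surjective : 0 < n → ∀ y → InFq y → ∃[ z ] Tr z ≡ y
  Tr-surjective 0<n y y∈Fq with Tr-nonzero 0<n
  ... | w , Tr-w≢0 = a * w , (begin
    Tr (a * w)               ≡⟨ traceSum-* n w a∈Fq ⟩
    a * Tr w                 ≡⟨ *-assoc y _ _ ⟩
    y * ((Tr w) ⁻¹ * Tr w)   ≡⟨ cong (y *_) (⁻¹-inverseˡ (Tr w) Tr-w≢0) ⟩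
    y * 1#                   ≡⟨ *-identityʳ y ⟩
    y                        ∎)
    where
    open ≡-Reasoning
    a = y * (Tr w) ⁻¹
    a∈Fq : InFq a
    a∈Fq = InFq-* y∈Fq (InFq-⁻¹ Tr-w≢0 (Tr-InFq w))

module PermutationCriterion (K : FiniteField) (q n : ℕ) {p k : ℕ} (p-prime : Prime p) (0<k : 0 < k)
       (q≡p^k : q ≡ p ℕ.^ k) (card≡q^n : FiniteField.card K ≡ q ℕ.^ n) (0<n : 0 < n)
       (b c : FiniteField.Carrier K) (b∉Fq : ¬ FieldExt.InFq K q n b) where
  open FiniteField K
  open FieldExt K q n
  open FiniteFieldProperties K
  open SubfieldTrace K q n p-prime 0<k q≡p^k card≡q^n

  f g : Carrier → Carrier
  f x = x + c / (Tr x + b)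
  g x = x + Tr (c / (x + b))

  InjectiveOnFq : (Carrier → Carrier) → Set
  InjectiveOnFq h = ∀ x y → InFq x → InFq y → h x ≡ h y → x ≡ y

  Criterion : Set
  Criterion = ∀ x₀ y₀ → InFq x₀ → InFq y₀ → x₀ ≢ y₀ → Tr (c / ((x₀ + b) * (y₀ + b))) ≢ 1#

  x+b≢0 : ∀ {x} → InFq x → x + b ≢ 0#
  x+b≢0 {x} x∈Fq x+b≡0 = b∉Fq (subst InFq -x≡b (InFq-neg x∈Fq))
    where
    -x≡b : - x ≡ b
    -x≡b = sym (+-inverseʳ-unique x b x+b≡0)

  g-InFq : ∀ x → InFq x → InFq (g x)
  g-InFq x x∈Fq = InFq-+ x∈Fq (Tr-InFq _)

  Tr∘f≡g∘Tr : ∀ x → Tr (f x) ≡ g (Tr x)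
  Tr∘f≡g∘Tr x = traceSum-+ n x _

  g-difference : ∀ {x y} → InFq x → InFq y →
                 g x + - g y ≡ (x + - y) * (1# + - Tr (c / ((x + b) * (y + b))))
  g-difference {x} {y} x∈Fq y∈Fq = begin
    (x + Tr A) + - (y + Tr B)       ≡⟨ solve 4 (λ x y a b → (x :+ a) :- (y :+ b) := (x :- y) :- (b :- a)) refl x y (Tr A) (Tr B) ⟩
    d + - (Tr B + - Tr A)           ≡⟨ cong (λ t → d + - t) (sym (Tr-sub B A)) ⟩
    d + - Tr (B + - A)              ≡⟨ cong (λ t → d + - Tr t) B-A≡d*w ⟩
    d + - Tr (d * w)                ≡⟨ cong (λ t → d + - t) (traceSum-* n w (InFq-+ x∈Fq (InFq-neg y∈Fq))) ⟩
    d + - (d * Tr w)                ≡⟨ cong (_+ - (d * Tr w)) (*-identityʳ d) ⟨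
    d * 1# + - (d * Tr w)           ≡⟨ x[y-z]≈xy-xz d 1# (Tr w) ⟨
    d * (1# + - Tr w)               ∎
    where
    open ≡-Reasoning
    A = c / (x + b)
    B = c / (y + b)
    d = x + - y
    w = c / ((x + b) * (y + b))
    B-A≡d*w : B + - A ≡ d * w
    B-A≡d*w = trans (/-difference c (x+b≢0 x∈Fq) (x+b≢0 y∈Fq))
      (cong (_* w) (solve 3 (λ x y b → (x :+ b) :- (y :+ b) := x :- y) refl x y b))

  f-injective⇒g-injective : (∀ x y → f x ≡ f y → x ≡ y) → InjectiveOnFq g
  f-injective⇒g-injective f-inj x y x∈Fq _ gx≡gy = trans (sym Tr-z≡x) (trans (cong Tr (f-inj z z′ fz≡fz′)) Tr-z′≡y)
    where
    open ≡-Reasoning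
    z : Carrier
    z = proj₁ (Tr-surjective 0<n x x∈Fq)
    Tr-z≡x : Tr z ≡ x
    Tr-z≡x = proj₂ (Tr-surjective 0<n x x∈Fq)
    A = c / (x + b)
    B = c / (y + b)
    -- z and z′ have the same image under f because Tr z = x and Tr z′ = y.
    z′ = (z + A) + - B
    Tr-z′≡y : Tr z′ ≡ y
    Tr-z′≡y = begin
      Tr ((z + A) + - B)        ≡⟨ Tr-sub (z + A) B ⟩
      Tr (z + A) + - Tr B       ≡⟨ cong (_+ - Tr B) (traceSum-+ n z A) ⟩
      (Tr z + Tr A) + - Tr B    ≡⟨ cong (λ t → (t + Tr A) + - Tr B) Tr-z≡x ⟩
      g x + - Tr B              ≡⟨ cong (_+ - Tr B) gx≡gy ⟩
      (y + Tr B) + - Tr B       ≡⟨ solve 2 (λ y t → (y :+ t) :- t := y) refl y (Tr B) ⟩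
      y                         ∎
    fz≡fz′ : f z ≡ f z′
    fz≡fz′ = begin
      z + c / (Tr z + b)        ≡⟨ cong (λ t → z + c / (t + b)) Tr-z≡x ⟩
      z + A                     ≡⟨ solve 2 (λ a t → a := (a :- t) :+ t) refl (z + A) B ⟩
      z′ + B                    ≡⟨ cong (λ t → z′ + c / (t + b)) Tr-z′≡y ⟨
      z′ + c / (Tr z′ + b)      ∎

  g-injective⇒f-injective : InjectiveOnFq g → ∀ x y → f x ≡ f y → x ≡ y
  g-injective⇒f-injective g-inj x y fx≡fy = +-cancelʳ (c / (Tr x + b)) x y (begin
    x + c / (Tr x + b)      ≡⟨ fx≡fy ⟩
    y + c / (Tr y + b)      ≡⟨ cong (λ t → y + c / (t + b)) Tr-x≡Tr-y ⟨
    y + c / (Tr x + b)      ∎)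
    where
    open ≡-Reasoning
    Tr-x≡Tr-y : Tr x ≡ Tr y
    Tr-x≡Tr-y = g-inj (Tr x) (Tr y) (Tr-InFq x) (Tr-InFq y)
      (trans (sym (Tr∘f≡g∘Tr x)) (trans (cong Tr fx≡fy) (Tr∘f≡g∘Tr y)))

  g-injective⇒criterion : InjectiveOnFq g → Criterion
  g-injective⇒criterion g-inj x y x∈Fq y∈Fq x≢y T≡1 = x≢y (g-inj x y x∈Fq y∈Fq (x-y≡0⇒x≡y _ _ (begin
    g x + - g y                                         ≡⟨ g-difference x∈Fq y∈Fq ⟩
    (x + - y) * (1# + - Tr (c / ((x + b) * (y + b))))   ≡⟨ cong (λ t → (x + - y) * (1# + - t)) T≡1 ⟩
    (x + - y) * (1# + - 1#)                             ≡⟨ cong ((x + - y) *_) (-‿inverseʳ 1#) ⟩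
    (x + - y) * 0#                                      ≡⟨ zeroʳ _ ⟩
    0#                                                  ∎)))
    where open ≡-Reasoning

  criterion⇒g-injective : Criterion → InjectiveOnFq g
  criterion⇒g-injective criterion x y x∈Fq y∈Fq gx≡gy = decide (x ≟ y)
    where
    decide : Dec (x ≡ y) → x ≡ y
    decide (yes x≡y) = x≡y
    decide (no x≢y)  = [ x-y≡0⇒x≡y x y , (λ 1-T≡0 → ⊥-elim (criterion x y x∈Fq y∈Fq x≢y (sym (x-y≡0⇒x≡y _ _ 1-T≡0)))) ]
      (x*y≡0⇒x≡0⊎y≡0 _ _ (trans (sym (g-difference x∈Fq y∈Fq)) (x≡y⇒x-y≡0 gx≡gy)))

  permutesFq : InjectiveOnFq g → PermutesFq g
  permutesFq g-inj = g-InFq , g-inj , injectiveOn⇒surjectiveOn InFq (λ x → x ^ q ≟ x) g g-InFq g-inj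

  permutesK⇔permutesFq : PermutesK f ⇔ PermutesFq g
  permutesK⇔permutesFq = mk⇔
    (λ (f-inj , _) → permutesFq (f-injective⇒g-injective (λ x y → f-inj)))
    (λ (_ , g-inj , _) → injective⇒bijective f (g-injective⇒f-injective g-inj))

  permutesFq⇔criterion : PermutesFq g ⇔ Criterion
  permutesFq⇔criterion = mk⇔ (λ (_ , g-inj , _) → g-injective⇒criterion g-inj) (permutesFq ∘ criterion⇒g-injective)

open import Data.Nat using (_^_)

mainTheorem3 : (q n : ℕ) → IsPrimePower q → 1 < n →
    (K : FiniteField) → FiniteField.card K ≡ q ^ n →
    let open FiniteField K
        open FieldExt K q n
    in (b c : Carrier) → ¬ InFq b → c ≢ 0# →
       (PermutesK (λ x → x + c / (Tr x + b)) ⇔ PermutesFq (λ x → x + Tr (c / (x + b))))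
       × (PermutesFq (λ x → x + Tr (c / (x + b)))
          ⇔ (∀ x₀ y₀ → InFq x₀ → InFq y₀ → x₀ ≢ y₀ → Tr (c / ((x₀ + b) * (y₀ + b))) ≢ 1#))
mainTheorem3 q n (p , k , p-prime , 0<k , q≡p^k) 1<n K card≡q^n b c b∉Fq _ =
  permutesK⇔permutesFq , permutesFq⇔criterion
  where open PermutationCriterion K q n p-prime 0<k q≡p^k card≡q^n (ℕ.<⇒≤ 1<n) b c b∉Fq
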